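{- Let $\mathcal C=\bigcup_n\mathcal C_n$ where $\mathcal C_n$ is the set of permutations in $\mathfrak S_n$ avoiding $2\text{ - }1\text{ - }3$ and $12\text{ - }3$. Label each $\pi\in\mathcal C_n$ by $(\ell(\pi),\pi_n)$. Then the permutation $1\in\mathcal C_1$ has label $(2,1)$, and for every $\pi\in\mathcal C_n$ with label $(\ell,r)$ (where always $\ell\ge r$), the multiset of labels of its children in $\mathcal C_{n+1}$ is: $(\ell+1,1),(\ell+1,2),\dots,(\ell+1,\ell)$ if $\ell=r$; and $(\ell+1,1),(\ell+1,2),\dots,(\ell+1,r),(r+1,r+1)$ if $\ell>r$.
   Context: $\mathfrak S_n$ is the set of permutations $\pi=\pi_1\cdots\pi_n$ of $\{1,\dots,n\}$. $\pi$ avoids $2\text{ - }1\text{ - }3$ if there are no $i<j<k$ with $\pi_j<\pi_i<\pi_k$; $\pi$ avoids $12\text{ - }3$ if there are no $i$ and $k>i+1$ with $\pi_i<\pi_{i+1}<\pi_k$. For $\pi\in\mathfrak S_n$ and $j\in\{1,\dots,n+1\}$, appending $j$ to $\pi$ gives the permutation of $\{1,\dots,n+1\}$ whose first $n$ entries are $\pi_i$ if $\pi_i<j$ and $\pi_i+1$ if $\pi_i\ge j$, and whose last entry is $j$. The children of $\pi\in\mathcal C_n$ are the permutations obtained by appending some $j$ to $\pi$ that lie in $\mathcal C_{n+1}$. For $\pi\in\mathfrak S_n$, $\ell(\pi)=n+1$ if $\pi=n(n-1)\cdots21$, and otherwise $\ell(\pi)=\min\{\pi_i:i>1,\ \pi_{i-1}<\pi_i\}$.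 -}

module Defs where

open import Data.Nat using (ℕ; zero; suc; _+_; _≤_; _<_; _<ᵇ_; _≡ᵇ_; _⊓_)
open import Data.Bool using (if_then_else_)
open import Data.Fin using (Fin; toℕ)
open import Data.List using (List; []; _∷_; _++_; map; upTo; downFrom; length; lookup; foldr)
open import Data.List.Properties using (≡-dec)
open import Data.List.Relation.Binary.Permutation.Propositional using (_↭_)
open import Data.Product using (Σ; _×_; _,_; ∃-syntax)
open import Relation.Nullary using (¬_; yes; no)
open import Relation.Binary.PropositionalEquality using (_≡_)
import Data.Nat as N

-- Permutations of {1,…,n} in one-line notation, as lists of naturals.
-- [1..n] and [n..1]
oneTo : ℕ → List ℕ
oneTo n = map suc (upTo n)

nDown : ℕ → List ℕ
nDown n = map suc (downFrom n)

IsPerm : ℕ → List ℕ → Set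
IsPerm n π = π ↭ oneTo n

-- π_i for a 0-based index i (paper indices are 1-based; only relative order matters)
_!_ : (π : List ℕ) → Fin (length π) → ℕ
π ! i = lookup π i

Contains2-1-3 : List ℕ → Set
Contains2-1-3 π = ∃[ i ] ∃[ j ] ∃[ k ]
  (toℕ i < toℕ j × toℕ j < toℕ k × π ! j < π ! i × π ! i < π ! k)

Avoids2-1-3 : List ℕ → Set
Avoids2-1-3 π = ¬ Contains2-1-3 π

Contains12-3 : List ℕ → Set
Contains12-3 π = ∃[ i ] ∃[ j ] ∃[ k ]
  (toℕ j ≡ suc (toℕ i) × toℕ j < toℕ k × π ! i < π ! j × π ! j < π ! k)

Avoids12-3 : List ℕ → Set
Avoids12-3 π = ¬ Contains12-3 π

C : ℕ → List ℕ → Set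
C n π = IsPerm n π × Avoids2-1-3 π × Avoids12-3 π

append : List ℕ → ℕ → List ℕ
append π j = map (λ x → if x <ᵇ j then x else suc x) π ++ (j ∷ [])

ascentTops : List ℕ → List ℕ
ascentTops [] = []
ascentTops (x ∷ []) = []
ascentTops (x ∷ y ∷ xs) =
  if x <ᵇ y then y ∷ ascentTops (y ∷ xs) else ascentTops (y ∷ xs)

-- ℓ(π): n+1 if π = n(n-1)…1, else the minimum of the ascent tops
-- (the fold starts at n+1, which does not affect a nonempty minimum of values ≤ n)
ell : List ℕ → ℕ
ell π with ≡-dec N._≟_ π (nDown (length π))
... | yes _ = suc (length π)
... | no _ = foldr _⊓_ (suc (length π)) (ascentTops π)

-- π_n (last entry; 0 for the empty list, never used)
lastEntry : List ℕ → ℕ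
lastEntry [] = 0
lastEntry (x ∷ []) = x
lastEntry (x ∷ y ∷ xs) = lastEntry (y ∷ xs)

label : List ℕ → ℕ × ℕ
label π = ell π , lastEntry π

expectedChildLabels : ℕ → ℕ → List (ℕ × ℕ)
expectedChildLabels l r =
  if l ≡ᵇ r
  then map (λ i → (suc l , i)) (oneTo l)
  else map (λ i → (suc l , i)) (oneTo r) ++ ((suc r , suc r) ∷ [])

module Submission where

-- Let π ∈ 𝒞_{n+1} have label (ℓ , r): ℓ is the least ascent top, r the last entry.
-- Appending j turns π into π′ = (π with every entry ≥ j raised by one) followed by j.
-- The raising is an order embedding, so a pattern occurrence in π′ that is not one
-- of π must end at the new entry.  Such occurrences are governed by two consequences
-- of pattern avoidance in π: the larger entry of any inversion exceeds r (2-1-3),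
-- and no ascent top is smaller than an entry further right (12-3).  This yields
-- r ≤ ℓ and shows that π′ ∈ 𝒞_{n+2} exactly when 1 ≤ j ≤ min(ℓ , r+1).  For j ≤ r
-- the ascent tops of π′ are those of π raised by one, giving the label (ℓ+1 , j);
-- for j = r+1 ≤ ℓ the new ascent r (r+1) has the least top, giving (r+1 , r+1).

open import Defs
open import Data.Nat using (ℕ; zero; suc; _≤_; _<_; _<ᵇ_; _≡ᵇ_; _⊓_; _≟_; z≤n; s≤s)
open import Data.Nat.Properties
open import Data.Bool using (true; false; if_then_else_)
open import Data.Fin using (Fin; toℕ; fromℕ<) renaming (zero to fzero; suc to fsuc)
open import Data.Fin.Properties using (toℕ<n; toℕ-fromℕ<)
open import Data.List using (List; []; _∷_; _++_; [_]; map; length; lookup; foldr; upTo)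
open import Data.List.Properties using (≡-dec; map-++; length-map; foldr-++; upTo-∷ʳ; length-upTo; ++-assoc; ++-identityʳ; map-cong-local)
open import Data.List.Membership.Propositional using (_∈_)
open import Data.List.Membership.Propositional.Properties using (∈-upTo⁺; ∈-upTo⁻; ∈-map⁺; ∈-map⁻; foldr-selective)
open import Data.List.Relation.Unary.Any using (here; there)
open import Data.List.Relation.Unary.All using (All; []; _∷_; tabulate) renaming (lookup to All-lookup)
import Data.List.Relation.Unary.All.Properties as All
open import Data.List.Relation.Unary.Unique.Propositional using (Unique)
open import Data.List.Relation.Unary.AllPairs using (_∷_)
import Data.List.Relation.Unary.Unique.Propositional.Properties as Unique
open import Data.List.Relation.Binary.Permutation.Propositional
  using (_↭_; ↭-refl; ↭-sym; ↭-trans; ↭-reflexive; ↭⇒↭ₛ; swap; module PermutationReasoning)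
open import Data.List.Relation.Binary.Permutation.Propositional.Properties
  using (++⁺ˡ; ++⁺ʳ; ∈-resp-↭; ↭-length) renaming (map⁺ to ↭-map⁺)
import Data.List.Relation.Binary.Permutation.Setoid.Properties as SetoidPerm
open import Data.Product using (Σ; _×_; _,_; proj₁; proj₂; ∃-syntax)
open import Data.Sum using (_⊎_; inj₁; inj₂; map₂)
open import Function using (_∘_)
open import Function.Bundles using (_⇔_; mk⇔; Equivalence)
open import Relation.Nullary using (¬_; Dec; yes; no; contradiction)
open import Relation.Nullary.Reflects using (Reflects; ofʸ; ofⁿ; fromEquivalence)
open import Relation.Binary.Definitions using (tri<; tri≈; tri>)
open import Relation.Binary.PropositionalEquality
  using (_≡_; refl; sym; trans; cong; cong₂; subst; subst₂; setoid; module ≡-Reasoning)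

-- Entry at a natural-number position (0 beyond the end).
at : List ℕ → ℕ → ℕ
at [] _ = 0
at (x ∷ xs) zero = x
at (x ∷ xs) (suc i) = at xs i

lookup≡at : ∀ xs (i : Fin (length xs)) → lookup xs i ≡ at xs (toℕ i)
lookup≡at (x ∷ xs) fzero = refl
lookup≡at (x ∷ xs) (fsuc i) = lookup≡at xs i

lookup-fromℕ< : ∀ xs {i} (i< : i < length xs) → lookup xs (fromℕ< i<) ≡ at xs i
lookup-fromℕ< (x ∷ xs) {zero} _ = refl
lookup-fromℕ< (x ∷ xs) {suc i} (s≤s i<) = lookup-fromℕ< xs i<

Occurs2-1-3 : List ℕ → Set
Occurs2-1-3 π = ∃[ a ] ∃[ b ] ∃[ c ]
  (a < b × b < c × c < length π × at π b < at π a × at π a < at π c)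

Occurs12-3 : List ℕ → Set
Occurs12-3 π = ∃[ a ] ∃[ c ]
  (suc a < c × c < length π × at π a < at π (suc a) × at π (suc a) < at π c)

contains⇒occurs2-1-3 : ∀ π → Contains2-1-3 π → Occurs2-1-3 π
contains⇒occurs2-1-3 π (i , j , k , i<j , j<k , πj<πi , πi<πk) =
  toℕ i , toℕ j , toℕ k , i<j , j<k , toℕ<n k ,
  subst₂ _<_ (lookup≡at π j) (lookup≡at π i) πj<πi ,
  subst₂ _<_ (lookup≡at π i) (lookup≡at π k) πi<πk

occurs⇒contains2-1-3 : ∀ π → Occurs2-1-3 π → Contains2-1-3 π
occurs⇒contains2-1-3 π (a , b , c , a<b , b<c , c<len , πb<πa , πa<πc) =
  fromℕ< a<len , fromℕ< b<len , fromℕ< c<len ,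
  subst₂ _<_ (sym (toℕ-fromℕ< a<len)) (sym (toℕ-fromℕ< b<len)) a<b ,
  subst₂ _<_ (sym (toℕ-fromℕ< b<len)) (sym (toℕ-fromℕ< c<len)) b<c ,
  subst₂ _<_ (sym (lookup-fromℕ< π b<len)) (sym (lookup-fromℕ< π a<len)) πb<πa ,
  subst₂ _<_ (sym (lookup-fromℕ< π a<len)) (sym (lookup-fromℕ< π c<len)) πa<πc
  where
  b<len = <-trans b<c c<len
  a<len = <-trans a<b b<len

contains⇒occurs12-3 : ∀ π → Contains12-3 π → Occurs12-3 π
contains⇒occurs12-3 π (i , j , k , j≡1+i , j<k , πi<πj , πj<πk) =
  toℕ i , toℕ k , subst (_< toℕ k) j≡1+i j<k , toℕ<n k ,
  subst₂ _<_ (lookup≡at π i) πj≡ πi<πj ,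
  subst₂ _<_ πj≡ (lookup≡at π k) πj<πk
  where
  πj≡ : lookup π j ≡ at π (suc (toℕ i))
  πj≡ = trans (lookup≡at π j) (cong (at π) j≡1+i)

occurs⇒contains12-3 : ∀ π → Occurs12-3 π → Contains12-3 π
occurs⇒contains12-3 π (a , c , 1+a<c , c<len , πa<πa' , πa'<πc) =
  fromℕ< a<len , fromℕ< a'<len , fromℕ< c<len ,
  trans (toℕ-fromℕ< a'<len) (cong suc (sym (toℕ-fromℕ< a<len))) ,
  subst₂ _<_ (sym (toℕ-fromℕ< a'<len)) (sym (toℕ-fromℕ< c<len)) 1+a<c ,
  subst₂ _<_ (sym (lookup-fromℕ< π a<len)) (sym (lookup-fromℕ< π a'<len)) πa<πa' ,
  subst₂ _<_ (sym (lookup-fromℕ< π a'<len)) (sym (lookup-fromℕ< π c<len)) πa'<πc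
  where
  a'<len = <-trans 1+a<c c<len
  a<len = <-trans (n<1+n a) a'<len

at-++ˡ : ∀ xs ys {i} → i < length xs → at (xs ++ ys) i ≡ at xs i
at-++ˡ (x ∷ xs) ys {zero} _ = refl
at-++ˡ (x ∷ xs) ys {suc i} (s≤s i<) = at-++ˡ xs ys i<

at-map : ∀ (f : ℕ → ℕ) xs {i} → i < length xs → at (map f xs) i ≡ f (at xs i)
at-map f (x ∷ xs) {zero} _ = refl
at-map f (x ∷ xs) {suc i} (s≤s i<) = at-map f xs i<

at-∈ : ∀ xs {i} → i < length xs → at xs i ∈ xs
at-∈ (x ∷ xs) {zero} _ = here refl
at-∈ (x ∷ xs) {suc i} (s≤s i<) = there (at-∈ xs i<)

∈⇒at : ∀ {x} xs → x ∈ xs → ∃[ i ] (i < length xs × at xs i ≡ x)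
∈⇒at (y ∷ xs) (here refl) = zero , s≤s z≤n , refl
∈⇒at (y ∷ xs) (there x∈) with ∈⇒at xs x∈
... | i , i< , xs[i]≡x = suc i , s≤s i< , xs[i]≡x

at-injective : ∀ xs {i k} → Unique xs → i < length xs → k < length xs →
  at xs i ≡ at xs k → i ≡ k
at-injective (x ∷ xs) {zero} {zero} _ _ _ _ = refl
at-injective (x ∷ xs) {zero} {suc k} (x∉ ∷ _) _ (s≤s k<) x≡ =
  contradiction x≡ (All-lookup x∉ (at-∈ xs k<))
at-injective (x ∷ xs) {suc i} {zero} (x∉ ∷ _) (s≤s i<) _ ≡x =
  contradiction (sym ≡x) (All-lookup x∉ (at-∈ xs i<))
at-injective (x ∷ xs) {suc i} {suc k} (_ ∷ u) (s≤s i<) (s≤s k<) eq =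
  cong suc (at-injective xs u i< k< eq)

mono⇒reflects-< : ∀ {f : ℕ → ℕ} → (∀ {x y} → x < y → f x < f y) → ∀ {x y} → f x < f y → x < y
mono⇒reflects-< f-mono {x} {y} fx<fy with <-cmp x y
... | tri< x<y _ _ = x<y
... | tri≈ _ refl _ = contradiction fx<fy (<-irrefl refl)
... | tri> _ _ y<x = contradiction fx<fy (<-asym (f-mono y<x))

shift : ℕ → ℕ → ℕ
shift j x = if x <ᵇ j then x else suc x

shift-< : ∀ {j x} → x < j → shift j x ≡ x
shift-< {j} {x} x<j with x <ᵇ j | <ᵇ-reflects-< x j
... | true | _ = refl
... | false | ofⁿ x≮j = contradiction x<j x≮j

shift-≥ : ∀ {j x} → j ≤ x → shift j x ≡ suc x
shift-≥ {j} {x} j≤x with x <ᵇ j | <ᵇ-reflects-< x j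
... | true | ofʸ x<j = contradiction j≤x (<⇒≱ x<j)
... | false | _ = refl

shift-mono-< : ∀ {j x y} → x < y → shift j x < shift j y
shift-mono-< {j} {x} {y} x<y with x <ᵇ j | <ᵇ-reflects-< x j | y <ᵇ j | <ᵇ-reflects-< y j
... | true | _ | true | _ = x<y
... | true | _ | false | _ = m≤n⇒m≤1+n x<y
... | false | ofⁿ x≮j | true | ofʸ y<j = contradiction (<-trans x<y y<j) x≮j
... | false | _ | false | _ = s≤s x<y

shift<⇒< : ∀ {j x} → shift j x < j → x < j
shift<⇒< {j} {x} sx<j with x <ᵇ j | <ᵇ-reflects-< x j
... | true | ofʸ x<j = x<j
... | false | _ = <-trans (n<1+n x) sx<j

length-append : ∀ π j → length (append π j) ≡ suc (length π)
length-append [] j = refl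
length-append (x ∷ π) j = cong suc (length-append π j)

at-append-old : ∀ π j {i} → i < length π → at (append π j) i ≡ shift j (at π i)
at-append-old π j {i} i< =
  trans (at-++ˡ (map (shift j) π) [ j ] (subst (i <_) (sym (length-map (shift j) π)) i<))
        (at-map (shift j) π i<)

at-append-new : ∀ π j → at (append π j) (length π) ≡ j
at-append-new [] j = refl
at-append-new (x ∷ π) j = at-append-new π j

oneTo-suc : ∀ n → oneTo (suc n) ≡ oneTo n ++ [ suc n ]
oneTo-suc n = trans (cong (map suc) (sym (upTo-∷ʳ n))) (map-++ suc (upTo n) [ n ])

length-oneTo : ∀ n → length (oneTo n) ≡ n
length-oneTo n = trans (length-map suc (upTo n)) (length-upTo n)

∈-oneTo⁻ : ∀ {x n} → x ∈ oneTo n → 1 ≤ x × x ≤ n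
∈-oneTo⁻ x∈ with ∈-map⁻ suc x∈
... | y , y∈ , refl = s≤s z≤n , ∈-upTo⁻ y∈

∈-oneTo⁺ : ∀ {x n} → 1 ≤ x → x ≤ n → x ∈ oneTo n
∈-oneTo⁺ {suc y} _ x≤n = ∈-map⁺ suc (∈-upTo⁺ x≤n)

unique-oneTo : ∀ n → Unique (oneTo n)
unique-oneTo n = Unique.map⁺ suc-injective (Unique.upTo⁺ n)

shift-oneTo : ∀ {j} n → n < j → map (shift j) (oneTo n) ≡ oneTo n
shift-oneTo zero _ = refl
shift-oneTo {j} (suc n) n<j = begin
  map (shift j) (oneTo (suc n))          ≡⟨ cong (map (shift j)) (oneTo-suc n) ⟩
  map (shift j) (oneTo n ++ [ suc n ])   ≡⟨ map-++ (shift j) (oneTo n) [ suc n ] ⟩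
  map (shift j) (oneTo n) ++ [ shift j (suc n) ]
    ≡⟨ cong₂ (λ xs x → xs ++ [ x ]) (shift-oneTo n (<-trans (n<1+n n) n<j)) (shift-< n<j) ⟩
  oneTo n ++ [ suc n ]                   ≡⟨ oneTo-suc n ⟨
  oneTo (suc n)                          ∎
  where open ≡-Reasoning

-- Appending any admissible value to the identity permutation of length n gives
-- a permutation of 1,…,n+1.  By induction on n: unless j = n+1, the largest
-- entry (shifted to n+1) can be swapped past the new last entry j.
append-oneTo : ∀ n {j} → 1 ≤ j → j ≤ suc n → append (oneTo n) j ↭ oneTo (suc n)
append-oneTo n {j} 1≤j j≤1+n with m≤n⇒m<n∨m≡n j≤1+n
... | inj₂ refl = ↭-reflexive (trans (cong (_++ [ j ]) (shift-oneTo n ≤-refl)) (sym (oneTo-suc n)))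
append-oneTo zero {j} 1≤j j≤1 | inj₁ (s≤s j≤0) = contradiction j≤0 (<⇒≱ 1≤j)
append-oneTo (suc n) {j} 1≤j j≤2+n | inj₁ (s≤s j≤1+n) = begin
  map (shift j) (oneTo (suc n)) ++ [ j ]
    ≡⟨ cong (λ xs → map (shift j) xs ++ [ j ]) (oneTo-suc n) ⟩
  map (shift j) (oneTo n ++ [ suc n ]) ++ [ j ]
    ≡⟨ cong (_++ [ j ]) (map-++ (shift j) (oneTo n) [ suc n ]) ⟩
  (map (shift j) (oneTo n) ++ [ shift j (suc n) ]) ++ [ j ]
    ≡⟨ ++-assoc (map (shift j) (oneTo n)) _ _ ⟩
  map (shift j) (oneTo n) ++ shift j (suc n) ∷ j ∷ []
    ≡⟨ cong (λ x → map (shift j) (oneTo n) ++ x ∷ j ∷ []) (shift-≥ j≤1+n) ⟩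
  map (shift j) (oneTo n) ++ suc (suc n) ∷ j ∷ []
    ↭⟨ ++⁺ˡ (map (shift j) (oneTo n)) (swap (suc (suc n)) j ↭-refl) ⟩
  map (shift j) (oneTo n) ++ j ∷ suc (suc n) ∷ []
    ≡⟨ ++-assoc (map (shift j) (oneTo n)) [ j ] [ suc (suc n) ] ⟨
  append (oneTo n) j ++ [ suc (suc n) ]
    ↭⟨ ++⁺ʳ [ suc (suc n) ] (append-oneTo n 1≤j j≤1+n) ⟩
  oneTo (suc n) ++ [ suc (suc n) ]
    ≡⟨ oneTo-suc (suc n) ⟨
  oneTo (suc (suc n)) ∎
  where open PermutationReasoning

append-↭ : ∀ {π n j} → π ↭ oneTo n → 1 ≤ j → j ≤ suc n → append π j ↭ oneTo (suc n)
append-↭ {n = n} {j = j} π↭ 1≤j j≤1+n =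
  ↭-trans (++⁺ʳ [ j ] (↭-map⁺ (shift j) π↭)) (append-oneTo n 1≤j j≤1+n)

unique-perm : ∀ {π n} → π ↭ oneTo n → Unique π
unique-perm {n = n} π↭ =
  SetoidPerm.Unique-resp-↭ (setoid ℕ) (↭⇒↭ₛ (↭-sym π↭)) (unique-oneTo n)

Ascent : List ℕ → ℕ → Set
Ascent π i = suc i < length π × at π i < at π (suc i)

AscentTop : List ℕ → ℕ → Set
AscentTop π t = ∃[ i ] (Ascent π i × at π (suc i) ≡ t)

top-∷⁻ : ∀ x y xs {t} → t ∈ ascentTops (x ∷ y ∷ xs) → (t ≡ y × x < y) ⊎ t ∈ ascentTops (y ∷ xs)
top-∷⁻ x y xs t∈ with x <ᵇ y | <ᵇ-reflects-< x y
top-∷⁻ x y xs (here t≡y) | true | ofʸ x<y = inj₁ (t≡y , x<y)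
top-∷⁻ x y xs (there t∈) | true | _ = inj₂ t∈
top-∷⁻ x y xs t∈ | false | _ = inj₂ t∈

ascentTop-∷ : ∀ x y xs {t} → (t ≡ y × x < y) ⊎ AscentTop (y ∷ xs) t → AscentTop (x ∷ y ∷ xs) t
ascentTop-∷ x y xs (inj₁ (refl , x<y)) = zero , (s≤s (s≤s z≤n) , x<y) , refl
ascentTop-∷ x y xs (inj₂ (i , (i< , asc) , eq)) = suc i , (s≤s i< , asc) , eq

top⇒ascent : ∀ π {t} → t ∈ ascentTops π → AscentTop π t
top⇒ascent (x ∷ y ∷ xs) t∈ =
  ascentTop-∷ x y xs (map₂ (top⇒ascent (y ∷ xs)) (top-∷⁻ x y xs t∈))

top-∷-ascent : ∀ {x y} xs → x < y → ascentTops (x ∷ y ∷ xs) ≡ y ∷ ascentTops (y ∷ xs)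
top-∷-ascent {x} {y} xs x<y with x <ᵇ y | <ᵇ-reflects-< x y
... | true | _ = refl
... | false | ofⁿ x≮y = contradiction x<y x≮y

top-∷-descent : ∀ {x y} xs → ¬ x < y → ascentTops (x ∷ y ∷ xs) ≡ ascentTops (y ∷ xs)
top-∷-descent {x} {y} xs x≮y with x <ᵇ y | <ᵇ-reflects-< x y
... | true | ofʸ x<y = contradiction x<y x≮y
... | false | _ = refl

ascent⇒top : ∀ π {i} → Ascent π i → at π (suc i) ∈ ascentTops π
ascent⇒top (x ∷ y ∷ xs) {zero} (_ , x<y) = subst (y ∈_) (sym (top-∷-ascent xs x<y)) (here refl)
ascent⇒top (x ∷ y ∷ xs) {suc i} (s≤s i< , asc) with x <? y
... | yes x<y = subst (_ ∈_) (sym (top-∷-ascent xs x<y)) (there (ascent⇒top (y ∷ xs) (i< , asc)))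
... | no x≮y = subst (_ ∈_) (sym (top-∷-descent xs x≮y)) (ascent⇒top (y ∷ xs) (i< , asc))

newTop : List ℕ → ℕ → List ℕ
newTop [] y = []
newTop (x ∷ xs) y = if lastEntry (x ∷ xs) <ᵇ y then [ y ] else []

newTop-< : ∀ xs {y} → 1 ≤ length xs → lastEntry xs < y → newTop xs y ≡ [ y ]
newTop-< (x ∷ xs) {y} _ l<y with lastEntry (x ∷ xs) <ᵇ y | <ᵇ-reflects-< (lastEntry (x ∷ xs)) y
... | true | _ = refl
... | false | ofⁿ l≮y = contradiction l<y l≮y

newTop-≮ : ∀ xs {y} → ¬ lastEntry xs < y → newTop xs y ≡ []
newTop-≮ [] _ = refl
newTop-≮ (x ∷ xs) {y} l≮y with lastEntry (x ∷ xs) <ᵇ y | <ᵇ-reflects-< (lastEntry (x ∷ xs)) y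
... | true | ofʸ l<y = contradiction l<y l≮y
... | false | _ = refl

ascentTops-snoc : ∀ xs y → ascentTops (xs ++ [ y ]) ≡ ascentTops xs ++ newTop xs y
ascentTops-snoc [] y = refl
ascentTops-snoc (x ∷ []) y = refl
ascentTops-snoc (x ∷ x′ ∷ xs) y = extend (ascentTops-snoc (x′ ∷ xs) y)
  where
  extend : ascentTops ((x′ ∷ xs) ++ [ y ]) ≡ ascentTops (x′ ∷ xs) ++ newTop (x′ ∷ xs) y →
    ascentTops ((x ∷ x′ ∷ xs) ++ [ y ]) ≡ ascentTops (x ∷ x′ ∷ xs) ++ newTop (x ∷ x′ ∷ xs) y
  extend ih with x <ᵇ x′
  ... | true = cong (x′ ∷_) ih
  ... | false = ih

ascentTops-map : ∀ (f : ℕ → ℕ) → (∀ {x y} → x < y → f x < f y) →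
  ∀ xs → ascentTops (map f xs) ≡ map f (ascentTops xs)
ascentTops-map f f-mono [] = refl
ascentTops-map f f-mono (x ∷ []) = refl
ascentTops-map f f-mono (x ∷ y ∷ xs) = extend (x <? y) (ascentTops-map f f-mono (y ∷ xs))
  where
  open ≡-Reasoning
  extend : Dec (x < y) → ascentTops (map f (y ∷ xs)) ≡ map f (ascentTops (y ∷ xs)) →
    ascentTops (map f (x ∷ y ∷ xs)) ≡ map f (ascentTops (x ∷ y ∷ xs))
  extend (yes x<y) ih = begin
    ascentTops (f x ∷ f y ∷ map f xs)       ≡⟨ top-∷-ascent (map f xs) (f-mono x<y) ⟩
    f y ∷ ascentTops (map f (y ∷ xs))       ≡⟨ cong (f y ∷_) ih ⟩
    map f (y ∷ ascentTops (y ∷ xs))         ≡⟨ cong (map f) (top-∷-ascent xs x<y) ⟨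
    map f (ascentTops (x ∷ y ∷ xs))         ∎
  extend (no x≮y) ih = begin
    ascentTops (f x ∷ f y ∷ map f xs)       ≡⟨ top-∷-descent (map f xs) (x≮y ∘ mono⇒reflects-< f-mono) ⟩
    ascentTops (map f (y ∷ xs))             ≡⟨ ih ⟩
    map f (ascentTops (y ∷ xs))             ≡⟨ cong (map f) (top-∷-descent xs x≮y) ⟨
    map f (ascentTops (x ∷ y ∷ xs))         ∎

-- The decreasing permutation has no ascents, so ℓ(π) is always the minimum of
-- the ascent tops, with n+1 as the value of the empty minimum.
ascentTops-decreasing : ∀ m → ascentTops (nDown m) ≡ []
ascentTops-decreasing zero = refl
ascentTops-decreasing (suc zero) = refl
ascentTops-decreasing (suc (suc m)) =
  trans (top-∷-descent (nDown m) (<-asym (n<1+n (suc m)))) (ascentTops-decreasing (suc m))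

minTop : List ℕ → ℕ
minTop π = foldr _⊓_ (suc (length π)) (ascentTops π)

ell≡minTop : ∀ π → ell π ≡ minTop π
ell≡minTop π with ≡-dec _≟_ π (nDown (length π))
... | yes π≡ = cong (foldr _⊓_ (suc (length π)))
                 (sym (trans (cong ascentTops π≡) (ascentTops-decreasing (length π))))
... | no _ = refl

foldr⊓≤ : ∀ b {t} T → t ∈ T → foldr _⊓_ b T ≤ t
foldr⊓≤ b (x ∷ T) (here refl) = m⊓n≤m x _
foldr⊓≤ b (x ∷ T) (there t∈) = ≤-trans (m⊓n≤n x _) (foldr⊓≤ b T t∈)

foldr⊓<⇒∈ : ∀ b T {j} → foldr _⊓_ b T < j → j ≤ b → ∃[ t ] (t ∈ T × t < j)
foldr⊓<⇒∈ b T min<j j≤b with foldr-selective ⊓-sel b T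
... | inj₁ min≡b = contradiction (subst (_< _) min≡b min<j) (≤⇒≯ j≤b)
... | inj₂ min∈T = _ , min∈T , min<j

foldr⊓-lower : ∀ {b} T → All (b ≤_) T → foldr _⊓_ b T ≡ b
foldr⊓-lower [] [] = refl
foldr⊓-lower {b} (x ∷ T) (b≤x ∷ b≤T) = trans (cong (x ⊓_) (foldr⊓-lower T b≤T)) (m≥n⇒m⊓n≡n b≤x)

foldr⊓-shift : ∀ b {j} T → All (j ≤_) T → foldr _⊓_ (suc b) (map (shift j) T) ≡ suc (foldr _⊓_ b T)
foldr⊓-shift b [] [] = refl
foldr⊓-shift b {j} (x ∷ T) (j≤x ∷ j≤T) =
  cong₂ _⊓_ (shift-≥ j≤x) (foldr⊓-shift b T j≤T)

lastEntry-snoc : ∀ xs y → lastEntry (xs ++ [ y ]) ≡ y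
lastEntry-snoc [] y = refl
lastEntry-snoc (x ∷ []) y = refl
lastEntry-snoc (x ∷ x′ ∷ xs) y = lastEntry-snoc (x′ ∷ xs) y

lastEntry-map : ∀ (f : ℕ → ℕ) xs → 1 ≤ length xs → lastEntry (map f xs) ≡ f (lastEntry xs)
lastEntry-map f (x ∷ []) _ = refl
lastEntry-map f (x ∷ x′ ∷ xs) _ = lastEntry-map f (x′ ∷ xs) (s≤s z≤n)

lastEntry≡at : ∀ xs {m} → length xs ≡ suc m → lastEntry xs ≡ at xs m
lastEntry≡at (x ∷ []) {zero} _ = refl
lastEntry≡at (x ∷ x′ ∷ xs) {suc m} len = lastEntry≡at (x′ ∷ xs) (suc-injective len)

≡ᵇ-reflects-≡ : ∀ l r → Reflects (l ≡ r) (l ≡ᵇ r)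
≡ᵇ-reflects-≡ l r = fromEquivalence (≡ᵇ⇒≡ l r) (≡⇒≡ᵇ l r)

expected-equal : ∀ l → expectedChildLabels l l ≡ map (λ i → (suc l , i)) (oneTo l)
expected-equal l with l ≡ᵇ l | ≡ᵇ-reflects-≡ l l
... | true | _ = refl
... | false | ofⁿ l≢l = contradiction refl l≢l

expected-less : ∀ l r → r < l →
  expectedChildLabels l r ≡ map (λ i → (suc l , i)) (oneTo r) ++ [ (suc r , suc r) ]
expected-less l r r<l with l ≡ᵇ r | ≡ᵇ-reflects-≡ l r
... | true | ofʸ l≡r = contradiction (sym l≡r) (<⇒≢ r<l)
... | false | _ = refl

module Children (n : ℕ) (π : List ℕ) (π∈C : C (suc n) π) where

  π↭ : π ↭ oneTo (suc n)
  π↭ = proj₁ π∈C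

  avoids2-1-3 : ¬ Occurs2-1-3 π
  avoids2-1-3 = proj₁ (proj₂ π∈C) ∘ occurs⇒contains2-1-3 π

  avoids12-3 : ¬ Occurs12-3 π
  avoids12-3 = proj₂ (proj₂ π∈C) ∘ occurs⇒contains12-3 π

  ℓ r : ℕ
  ℓ = ell π
  r = lastEntry π

  length-π : length π ≡ suc n
  length-π = trans (↭-length π↭) (length-oneTo (suc n))

  in-π : ∀ {i} → i < suc n → i < length π
  in-π {i} = subst (i <_) (sym length-π)

  at-last : at π n ≡ r
  at-last = sym (lastEntry≡at π length-π)

  r≤1+n : r ≤ suc n
  r≤1+n = proj₂ (∈-oneTo⁻ (∈-resp-↭ π↭ (subst (_∈ π) at-last (at-∈ π (in-π ≤-refl)))))

  ℓ≡min : ℓ ≡ foldr _⊓_ (suc (suc n)) (ascentTops π)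
  ℓ≡min = trans (ell≡minTop π) (cong (λ m → foldr _⊓_ (suc m) (ascentTops π)) length-π)

  ℓ≤top : ∀ {t} → t ∈ ascentTops π → ℓ ≤ t
  ℓ≤top {t} t∈ = subst (_≤ t) (sym ℓ≡min) (foldr⊓≤ _ (ascentTops π) t∈)

  top-below : ∀ {j} → ℓ < j → j ≤ suc (suc n) → ∃[ t ] (t ∈ ascentTops π × t < j)
  top-below ℓ<j j≤ = foldr⊓<⇒∈ _ (ascentTops π) (subst (_< _) ℓ≡min ℓ<j) j≤

  -- 2-1-3 avoidance: the larger entry of an inversion exceeds the last entry.
  inversion-above-last : ∀ {a b} → a < b → b < suc n → at π b < at π a → r < at π a
  inversion-above-last {a} {b} a<b b<1+n πb<πa with m≤n⇒m<n∨m≡n (≤-pred b<1+n)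
  ... | inj₂ refl = subst (_< at π a) at-last πb<πa
  ... | inj₁ b<n with <-cmp (at π a) r
  ...   | tri< πa<r _ _ =
            contradiction (a , b , n , a<b , b<n , in-π ≤-refl , πb<πa , subst (_ <_) (sym at-last) πa<r)
                          avoids2-1-3
  ...   | tri≈ _ πa≡r _ =
            contradiction (at-injective π (unique-perm π↭) (in-π (<-trans a<b b<1+n)) (in-π ≤-refl)
                             (trans πa≡r (sym at-last)))
                          (<⇒≢ (<-trans a<b b<n))
  ...   | tri> _ _ r<πa = r<πa

  top≮later : ∀ {i c} → Ascent π i → suc i < c → c < suc n → ¬ at π (suc i) < at π c
  top≮later {i} {c} (_ , asc) 1+i<c c<1+n top<πc = avoids12-3 (i , c , 1+i<c , in-π c<1+n , asc , top<πc)

  -- r ≤ ℓ: an ascent top t < r cannot be π_n = r, so it would start a 12-3 ending at r.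
  last≤ell : r ≤ ℓ
  last≤ell = ≮⇒≥ λ ℓ<r → no-top-below-r (top-below ℓ<r (m≤n⇒m≤1+n r≤1+n))
    where
    no-top-below-r : ¬ (∃[ t ] (t ∈ ascentTops π × t < r))
    no-top-below-r (t , t∈ , t<r) with top⇒ascent π t∈
    ... | i , asc@(1+i<len , _) , πi+1≡t with m≤n⇒m<n∨m≡n (≤-pred (subst (suc i <_) length-π 1+i<len))
    ...   | inj₁ 1+i<n = top≮later asc 1+i<n ≤-refl (subst₂ _<_ (sym πi+1≡t) (sym at-last) t<r)
    ...   | inj₂ 1+i≡n = <-irrefl (trans (sym πi+1≡t) (trans (cong (at π) 1+i≡n) at-last)) t<r

  module Child (j : ℕ) where

    π′ : List ℕ
    π′ = append π j

    length-π′ : length π′ ≡ suc (suc n)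
    length-π′ = trans (length-append π j) (cong suc length-π)

    at-old : ∀ {i} → i < suc n → at π′ i ≡ shift j (at π i)
    at-old i<1+n = at-append-old π j (in-π i<1+n)

    at-new : at π′ (suc n) ≡ j
    at-new = subst (λ m → at π′ m ≡ j) length-π (at-append-new π j)

    in-π′ : ∀ {i} → i < suc (suc n) → i < length π′
    in-π′ {i} = subst (i <_) (sym length-π′)

    old-or-new : ∀ {c} → c < length π′ → c < suc n ⊎ c ≡ suc n
    old-or-new {c} c< = m≤n⇒m<n∨m≡n (≤-pred (subst (c <_) length-π′ c<))

    old-< : ∀ {a b} → a < suc n → b < suc n → at π′ a < at π′ b → at π a < at π b
    old-< a< b< π′a<π′b = mono⇒reflects-< (shift-mono-< {j}) (subst₂ _<_ (at-old a<) (at-old b<) π′a<π′b)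

    old-<-new : ∀ {a} → a < suc n → at π′ a < at π′ (suc n) → at π a < j
    old-<-new a< π′a<j = shift<⇒< (subst₂ _<_ (at-old a<) at-new π′a<j)

    -- Sufficiency: for j ≤ r+1 no 2-1-3 ends at the new entry, since the top
    -- of an inversion of π exceeds r.
    avoids2-1-3-append : j ≤ suc r → ¬ Occurs2-1-3 π′
    avoids2-1-3-append j≤1+r (a , b , c , a<b , b<c , c<len , π′b<π′a , π′a<π′c) with old-or-new c<len
    ... | inj₁ c<1+n =
          avoids2-1-3 (a , b , c , a<b , b<c , in-π c<1+n , old-< b<1+n a<1+n π′b<π′a , old-< a<1+n c<1+n π′a<π′c)
          where
          b<1+n = <-trans b<c c<1+n
          a<1+n = <-trans a<b b<1+n
    ... | inj₂ refl = <⇒≱ (inversion-above-last a<b b<c (old-< b<c a<1+n π′b<π′a))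
                          (≤-pred (≤-trans (old-<-new a<1+n π′a<π′c) j≤1+r))
          where
          a<1+n = <-trans a<b b<c

    -- Sufficiency: for j ≤ ℓ no 12-3 ends at the new entry, since every ascent
    -- top of π is at least ℓ.
    avoids12-3-append : j ≤ ℓ → ¬ Occurs12-3 π′
    avoids12-3-append j≤ℓ (a , c , 1+a<c , c<len , π′a<π′a+1 , π′a+1<π′c) with old-or-new c<len
    ... | inj₁ c<1+n =
          avoids12-3 (a , c , 1+a<c , in-π c<1+n , old-< a<1+n 1+a<1+n π′a<π′a+1 , old-< 1+a<1+n c<1+n π′a+1<π′c)
          where
          1+a<1+n = <-trans 1+a<c c<1+n
          a<1+n = <-trans (n<1+n a) 1+a<1+n
    ... | inj₂ refl = <⇒≱ (old-<-new 1+a<c π′a+1<π′c) (≤-trans j≤ℓ (ℓ≤top (ascent⇒top π ascent)))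
          where
          ascent : Ascent π a
          ascent = in-π 1+a<c , old-< (<-trans (n<1+n a) 1+a<c) 1+a<c π′a<π′a+1

    at-old-below : ∀ {i} → i < suc n → at π i < j → at π′ i ≡ at π i
    at-old-below i<1+n πi<j = trans (at-old i<1+n) (shift-< πi<j)

    -- Necessity: if r+1 < j, then the entry r+1 of π, the entry r and the new
    -- entry j form a 2-1-3.
    avoids2-1-3⇒ : j ≤ suc (suc n) → ¬ Occurs2-1-3 π′ → j ≤ suc r
    avoids2-1-3⇒ j≤2+n avoids = ≮⇒≥ λ 1+r<j → occurrence 1+r<j (∈⇒at π (r+1∈π 1+r<j))
      where
      r+1∈π : suc r < j → suc r ∈ π
      r+1∈π 1+r<j = ∈-resp-↭ (↭-sym π↭) (∈-oneTo⁺ (s≤s z≤n) (≤-pred (≤-trans 1+r<j j≤2+n)))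
      occurrence : suc r < j → ¬ (∃[ p ] (p < length π × at π p ≡ suc r))
      occurrence 1+r<j (p , p<len , πp≡1+r) with m≤n⇒m<n∨m≡n (≤-pred (subst (p <_) length-π p<len))
      ... | inj₂ refl = <-irrefl (trans (sym at-last) πp≡1+r) (n<1+n r)
      ... | inj₁ p<n = avoids (p , n , suc n , p<n , n<1+n n , in-π′ ≤-refl ,
              subst₂ _<_ (sym π′n≡r) (sym π′p≡1+r) (n<1+n r) ,
              subst₂ _<_ (sym π′p≡1+r) (sym at-new) 1+r<j)
        where
        π′n≡r : at π′ n ≡ r
        π′n≡r = trans (at-old-below ≤-refl (subst (_< j) (sym at-last) (<-trans (n<1+n r) 1+r<j))) at-last
        π′p≡1+r : at π′ p ≡ suc r
        π′p≡1+r = trans (at-old-below (m≤n⇒m≤1+n p<n) (subst (_< j) (sym πp≡1+r) 1+r<j)) πp≡1+r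

    -- Necessity: if ℓ < j, then an ascent of π with top below j, followed by
    -- the new entry j, forms a 12-3.
    avoids12-3⇒ : j ≤ suc (suc n) → ¬ Occurs12-3 π′ → j ≤ ℓ
    avoids12-3⇒ j≤2+n avoids = ≮⇒≥ λ ℓ<j → occurrence (top-below ℓ<j j≤2+n)
      where
      occurrence : ¬ (∃[ t ] (t ∈ ascentTops π × t < j))
      occurrence (t , t∈ , t<j) with top⇒ascent π t∈
      ... | i , (1+i<len , πi<πi+1) , πi+1≡t = avoids (i , suc n , 1+i<1+n , in-π′ ≤-refl ,
              subst₂ _<_ (sym (at-old i<1+n)) (sym (at-old 1+i<1+n)) (shift-mono-< {j} πi<πi+1) ,
              subst₂ _<_ (sym (trans (at-old-below 1+i<1+n (subst (_< j) (sym πi+1≡t) t<j)) πi+1≡t)) (sym at-new) t<j)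
        where
        1+i<1+n = subst (suc i <_) length-π 1+i<len
        i<1+n = <-trans (n<1+n i) 1+i<1+n

    ascentTops-π′ : ascentTops π′ ≡ map (shift j) (ascentTops π) ++ newTop (map (shift j) π) j
    ascentTops-π′ = trans (ascentTops-snoc (map (shift j) π) j)
                          (cong (_++ newTop (map (shift j) π) j) (ascentTops-map (shift j) (shift-mono-< {j}) π))

    ell-π′ : ell π′ ≡ foldr _⊓_ (suc (suc (suc n))) (map (shift j) (ascentTops π) ++ newTop (map (shift j) π) j)
    ell-π′ = trans (ell≡minTop π′) (cong₂ (λ m T → foldr _⊓_ (suc m) T) length-π′ ascentTops-π′)

    lastEntry-shifted : lastEntry (map (shift j) π) ≡ shift j r
    lastEntry-shifted = lastEntry-map (shift j) π (subst (1 ≤_) (sym length-π) (s≤s z≤n))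

    -- For j ≤ r no ascent is created and all ascent tops move up by one.
    label-low : j ≤ r → label π′ ≡ (suc ℓ , j)
    label-low j≤r = cong₂ _,_ ell-low (lastEntry-snoc (map (shift j) π) j)
      where
      open ≡-Reasoning
      no-new-top : newTop (map (shift j) π) j ≡ []
      no-new-top = newTop-≮ (map (shift j) π) λ last<j →
        <⇒≱ (subst (_< j) (trans lastEntry-shifted (shift-≥ j≤r)) last<j) (m≤n⇒m≤1+n j≤r)
      j≤tops : All (j ≤_) (ascentTops π)
      j≤tops = tabulate λ t∈ → ≤-trans (≤-trans j≤r last≤ell) (ℓ≤top t∈)
      ell-low : ell π′ ≡ suc ℓ
      ell-low = begin
        ell π′
          ≡⟨ ell-π′ ⟩
        foldr _⊓_ (suc (suc (suc n))) (map (shift j) (ascentTops π) ++ newTop (map (shift j) π) j)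
          ≡⟨ cong (λ N → foldr _⊓_ (suc (suc (suc n))) (map (shift j) (ascentTops π) ++ N)) no-new-top ⟩
        foldr _⊓_ (suc (suc (suc n))) (map (shift j) (ascentTops π) ++ [])
          ≡⟨ cong (foldr _⊓_ (suc (suc (suc n)))) (++-identityʳ (map (shift j) (ascentTops π))) ⟩
        foldr _⊓_ (suc (suc (suc n))) (map (shift j) (ascentTops π))
          ≡⟨ foldr⊓-shift (suc (suc n)) (ascentTops π) j≤tops ⟩
        suc (foldr _⊓_ (suc (suc n)) (ascentTops π))
          ≡⟨ cong suc ℓ≡min ⟨
        suc ℓ ∎

  -- For j = r+1 < ℓ+1 the new ascent r(r+1) has the smallest top.
  label-high : r < ℓ → label (append π (suc r)) ≡ (suc r , suc r)
  label-high r<ℓ = cong₂ _,_ ell-high (lastEntry-snoc (map (shift (suc r)) π) (suc r))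
    where
    open Child (suc r)
    open ≡-Reasoning
    new-top : newTop (map (shift (suc r)) π) (suc r) ≡ [ suc r ]
    new-top = newTop-< (map (shift (suc r)) π) (subst (1 ≤_) (sym (trans (length-map _ π) length-π)) (s≤s z≤n))
                (subst (_< suc r) (sym (trans lastEntry-shifted (shift-< (n<1+n r)))) (n<1+n r))
    r+1≤tops : All (suc r ≤_) (map (shift (suc r)) (ascentTops π))
    r+1≤tops = All.map⁺ (tabulate λ {t} t∈ →
      let r+1≤t = ≤-trans r<ℓ (ℓ≤top t∈) in subst (suc r ≤_) (sym (shift-≥ r+1≤t)) (m≤n⇒m≤1+n r+1≤t))
    ell-high : ell π′ ≡ suc r
    ell-high = begin
      ell π′
        ≡⟨ ell-π′ ⟩
      foldr _⊓_ (suc (suc (suc n))) (map (shift (suc r)) (ascentTops π) ++ newTop (map (shift (suc r)) π) (suc r))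
        ≡⟨ cong (λ N → foldr _⊓_ (suc (suc (suc n))) (map (shift (suc r)) (ascentTops π) ++ N)) new-top ⟩
      foldr _⊓_ (suc (suc (suc n))) (map (shift (suc r)) (ascentTops π) ++ [ suc r ])
        ≡⟨ foldr-++ _⊓_ (suc (suc (suc n))) (map (shift (suc r)) (ascentTops π)) [ suc r ] ⟩
      foldr _⊓_ (suc r ⊓ suc (suc (suc n))) (map (shift (suc r)) (ascentTops π))
        ≡⟨ cong (λ b → foldr _⊓_ b (map (shift (suc r)) (ascentTops π))) (m≤n⇒m⊓n≡m (s≤s (m≤n⇒m≤1+n r≤1+n))) ⟩
      foldr _⊓_ (suc r) (map (shift (suc r)) (ascentTops π))
        ≡⟨ foldr⊓-lower _ r+1≤tops ⟩
      suc r ∎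

  IsChild : ℕ → Set
  IsChild j = 1 ≤ j × j ≤ suc (suc n) × C (suc (suc n)) (append π j)

  isChild⇔ : ∀ j → IsChild j ⇔ (1 ≤ j × j ≤ ℓ × j ≤ suc r)
  isChild⇔ j = mk⇔ necessary sufficient
    where
    open Child j
    necessary : IsChild j → 1 ≤ j × j ≤ ℓ × j ≤ suc r
    necessary (1≤j , j≤2+n , _ , avoids-2-1-3 , avoids-12-3) =
      1≤j , avoids12-3⇒ j≤2+n (avoids-12-3 ∘ occurs⇒contains12-3 π′)
          , avoids2-1-3⇒ j≤2+n (avoids-2-1-3 ∘ occurs⇒contains2-1-3 π′)
    sufficient : 1 ≤ j × j ≤ ℓ × j ≤ suc r → IsChild j
    sufficient (1≤j , j≤ℓ , j≤1+r) =
      1≤j , j≤2+n , append-↭ π↭ 1≤j j≤2+n ,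
      avoids2-1-3-append j≤1+r ∘ contains⇒occurs2-1-3 π′ ,
      avoids12-3-append j≤ℓ ∘ contains⇒occurs12-3 π′
      where
      j≤2+n = ≤-trans j≤1+r (s≤s r≤1+n)

  childLabel : ℕ → ℕ × ℕ
  childLabel j = label (append π j)

  ChildList : Set
  ChildList = Σ (List ℕ) λ js → Unique js × ((j : ℕ) → (j ∈ js) ⇔ IsChild j)
                                × (map childLabel js ↭ expectedChildLabels ℓ r)

  children-upTo : ∀ m → (∀ {j} → j ≤ m ⇔ (j ≤ ℓ × j ≤ suc r)) →
    map childLabel (oneTo m) ≡ expectedChildLabels ℓ r → ChildList
  children-upTo m bound labels = oneTo m , unique-oneTo m , (λ j → mk⇔ to from) , ↭-reflexive labels
    where
    to : ∀ {j} → j ∈ oneTo m → IsChild j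
    to {j} j∈ with ∈-oneTo⁻ j∈
    ... | 1≤j , j≤m = Equivalence.from (isChild⇔ j) (1≤j , Equivalence.to bound j≤m)
    from : ∀ {j} → IsChild j → j ∈ oneTo m
    from {j} child with Equivalence.to (isChild⇔ j) child
    ... | 1≤j , j≤ℓ×j≤1+r = ∈-oneTo⁺ 1≤j (Equivalence.from bound j≤ℓ×j≤1+r)

  labels-equal : r ≡ ℓ → map childLabel (oneTo ℓ) ≡ expectedChildLabels ℓ r
  labels-equal r≡ℓ = begin
    map childLabel (oneTo ℓ)
      ≡⟨ map-cong-local (tabulate λ {j} j∈ → Child.label-low j (subst (j ≤_) (sym r≡ℓ) (proj₂ (∈-oneTo⁻ j∈)))) ⟩
    map (λ i → (suc ℓ , i)) (oneTo ℓ)   ≡⟨ expected-equal ℓ ⟨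
    expectedChildLabels ℓ ℓ             ≡⟨ cong (expectedChildLabels ℓ) r≡ℓ ⟨
    expectedChildLabels ℓ r             ∎
    where open ≡-Reasoning

  labels-less : r < ℓ → map childLabel (oneTo (suc r)) ≡ expectedChildLabels ℓ r
  labels-less r<ℓ = begin
    map childLabel (oneTo (suc r))                        ≡⟨ cong (map childLabel) (oneTo-suc r) ⟩
    map childLabel (oneTo r ++ [ suc r ])                 ≡⟨ map-++ childLabel (oneTo r) [ suc r ] ⟩
    map childLabel (oneTo r) ++ [ childLabel (suc r) ]
      ≡⟨ cong₂ (λ xs x → xs ++ [ x ])
               (map-cong-local (tabulate λ {j} j∈ → Child.label-low j (proj₂ (∈-oneTo⁻ j∈))))
               (label-high r<ℓ) ⟩
    map (λ i → (suc ℓ , i)) (oneTo r) ++ [ (suc r , suc r) ] ≡⟨ expected-less ℓ r r<ℓ ⟨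
    expectedChildLabels ℓ r                               ∎
    where open ≡-Reasoning

  children : ChildList
  children with m≤n⇒m<n∨m≡n last≤ell
  ... | inj₂ r≡ℓ = children-upTo ℓ (mk⇔ (λ j≤ℓ → j≤ℓ , ≤-trans j≤ℓ (subst (_≤ suc r) r≡ℓ (n≤1+n r))) proj₁)
                                 (labels-equal r≡ℓ)
  ... | inj₁ r<ℓ = children-upTo (suc r) (mk⇔ (λ j≤1+r → ≤-trans j≤1+r r<ℓ , j≤1+r) proj₂) (labels-less r<ℓ)

root : C 1 (1 ∷ []) × label (1 ∷ []) ≡ (2 , 1)
root = (↭-refl , no-2-1-3 , no-12-3) , refl
  where
  no-2-1-3 : Avoids2-1-3 (1 ∷ [])
  no-2-1-3 (fzero , fzero , _ , () , _)
  no-12-3 : Avoids12-3 (1 ∷ [])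
  no-12-3 (fzero , fzero , _ , () , _)

lemma3p1 : (C 1 (1 ∷ []) × label (1 ∷ []) ≡ (2 , 1))
    × ((n : ℕ) → 1 ≤ n → (π : List ℕ) → C n π →
        (proj₂ (label π) ≤ proj₁ (label π))
        × Σ (List ℕ) (λ js →
            Unique js
            × ((j : ℕ) → (j ∈ js) ⇔ (1 ≤ j × j ≤ suc n × C (suc n) (append π j)))
            × (map (λ j → label (append π j)) js
                ↭ expectedChildLabels (proj₁ (label π)) (proj₂ (label π)))))
lemma3p1 = root , λ { (suc n) _ π π∈C → Children.last≤ell n π π∈C , Children.children n π π∈C }
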